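{- Let $b\in\mathbb{N}$. A lattice point $(r,s)\in\mathbb{N}\times\mathbb{N}$ is $b$-visible if and only if $s=nr^b$ for some $n\in\mathbb{Q}$ and there does not exist a prime $p$ such that $p\mid r$ and $p^b\mid s$.
   Context: $\mathbb{N}=\{1,2,3,\ldots\}$. For $b\in\mathbb{N}$, a point $(r,s)\in\mathbb{N}\times\mathbb{N}$ is $b$-visible if it lies on the graph of $f(x)=nx^b$ for some $n\in\mathbb{Q}$ and there is no other point of $\mathbb{N}\times\mathbb{N}$ on the graph of $f$ lying between $(0,0)$ and $(r,s)$ (i.e. no $(r',s')\in\mathbb{N}\times\mathbb{N}$ with $s'=f(r')$ and $0<r'<r$). -}

module Defs where

open import Data.Nat using (ℕ; _^_; _<_; _≤_)
open import Data.Integer using (+_)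
open import Data.Rational using (ℚ; _/_; _*_)
open import Data.Product using (Σ; _×_)
open import Relation.Binary.PropositionalEquality using (_≡_)
open import Relation.Nullary using (¬_)

ι : ℕ → ℚ
ι m = (+ m) / 1

OnGraph : ℕ → ℚ → ℕ → ℕ → Set
OnGraph b n x y = ι y ≡ n * ι (x ^ b)

Visible : ℕ → ℕ → ℕ → Set
Visible b r s =
  Σ ℚ λ n → OnGraph b n r s
    × ¬ (Σ ℕ λ r' → Σ ℕ λ s' → 1 ≤ r' × 1 ≤ s' × r' < r × OnGraph b n r' s')

-- Two points (r , s) and (r' , s') of ℕ×ℕ lie on a common curve
-- y = n·x^b exactly when they satisfy the cross relation
-- s·r'^b = s'·r^b.  The theorem then reduces to arithmetic in ℕ:
--
-- * If a prime p has p ∣ r and p^b ∣ s, say r = R·p and s = S·p^b,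
--   then (R , S) lies on the same curve and R < r, so (r , s) is not
--   b-visible.
-- * Conversely, let (r' , s') with 0 < r' < r satisfy the cross
--   relation.  Dividing r and r' by g = gcd r r' gives coprime R' < R
--   with s·R'^b = s'·R^b, hence R^b ∣ s; any prime p ∣ R then has
--   p ∣ r and p^b ∣ s.

module Submission where

open import Defs
open import Data.Nat using (ℕ; _^_; _≤_)
open import Data.Nat.Divisibility using (_∣_)
open import Data.Nat.Primality using (Prime)
open import Data.Rational using (ℚ)
open import Data.Product using (Σ; _×_)
open import Function.Bundles using (_⇔_)
open import Relation.Nullary using (¬_)

open import Data.Nat as ℕ using (zero; suc; _*_; _<_; NonZero; >-nonZero; >-nonZero⁻¹)
import Data.Nat.Properties as ℕP
open import Data.Nat.Divisibility
  using (divides; ∣-refl; ∣-trans; ∣1⇒≡1; *-pres-∣; m∣m*n; n∣m*n)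
open import Data.Nat.DivMod using (_/_; m/n*n≡m)
open import Data.Nat.GCD using (gcd; gcd[m,n]∣m; gcd[m,n]∣n; gcd[m,n]≢0)
open import Data.Nat.Coprimality using (Coprime; coprime-divisor; coprime-/gcd)
import Data.Nat.Coprimality as Coprime
open import Data.Nat.Primality using (prime⇒nonZero; prime⇒nonTrivial)
open import Data.Nat.Primality.Factorisation using (factorise)
open import Data.List using ([]; _∷_)
open import Data.List.Relation.Unary.All using (_∷_)
open import Data.Integer using (+_)
import Data.Integer.Properties as ℤP
open import Data.Rational as ℚ using (mkℚ; 1/_; 1ℚ)
import Data.Rational.Properties as ℚP
open import Data.Product using (_,_)
open import Data.Sum using (inj₂)
open import Data.Empty using (⊥-elim)
open import Relation.Binary.PropositionalEquality
open import Function.Bundles using (mk⇔)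

^-distribʳ-* : ∀ a c k → (a * c) ^ k ≡ a ^ k * c ^ k
^-distribʳ-* a c zero    = refl
^-distribʳ-* a c (suc k) rewrite ^-distribʳ-* a c k =
  ℕP.[m*n]*[o*p]≡[m*o]*[n*p] a c (a ^ k) (c ^ k)

^-monoˡ-∣ : ∀ {p r} k → p ∣ r → p ^ k ∣ r ^ k
^-monoˡ-∣ zero    _   = ∣-refl
^-monoˡ-∣ (suc k) p∣r = *-pres-∣ p∣r (^-monoˡ-∣ k p∣r)

factor-pos : ∀ {m} k {j} → 1 ≤ m → m ≡ k * j → 1 ≤ k
factor-pos k 1≤m refl = >-nonZero⁻¹ k {{ℕP.m*n≢0⇒m≢0 k {{>-nonZero 1≤m}}}}

quotient-< : ∀ {r R p} → 1 ≤ r → 1 < p → r ≡ R * p → R < r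
quotient-< {R = R} {p} 1≤r 1<p refl =
  ℕP.m<m*n R p {{>-nonZero (factor-pos R 1≤r refl)}} 1<p

primeDivisor : ∀ n → 1 < n → Σ ℕ λ p → Prime p × p ∣ n
primeDivisor n@(suc _) 1<n with factorise n
... | record { factors = [] ; isFactorisation = n≡1 } =
  ⊥-elim (ℕP.<-irrefl (sym n≡1) 1<n)
... | record { factors = p ∷ _ ; isFactorisation = n≡∏ ; factorsPrime = p-prime ∷ _ } =
  p , p-prime , subst (p ∣_) (sym n≡∏) (m∣m*n _)

-- m coprime to n and to o is coprime to n * o: a common divisor d of m
-- and n * o is coprime to n (as d ∣ m), so it divides o.
coprime-*ʳ : ∀ {m n o} → Coprime m n → Coprime m o → Coprime m (n * o)
coprime-*ʳ m⊥n m⊥o (d∣m , d∣no) =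
  m⊥o (d∣m , coprime-divisor (λ (e∣d , e∣n) → m⊥n (∣-trans e∣d d∣m , e∣n)) d∣no)

coprime-^ʳ : ∀ {m n} k → Coprime m n → Coprime m (n ^ k)
coprime-^ʳ zero    _   (_ , d∣1) = ∣1⇒≡1 d∣1
coprime-^ʳ (suc k) m⊥n = coprime-*ʳ m⊥n (coprime-^ʳ k m⊥n)

coprime-^ : ∀ {m n} k → Coprime m n → Coprime (m ^ k) (n ^ k)
coprime-^ k m⊥n = coprime-^ʳ k (Coprime.sym (coprime-^ʳ k (Coprime.sym m⊥n)))

record CoprimeReduction (r r' : ℕ) : Set where
  field
    g R R'   : ℕ
    g-pos    : 1 ≤ g
    r≡R*g    : r ≡ R * g
    r'≡R'*g  : r' ≡ R' * g
    coprime  : Coprime R R'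

coprimeReduction : ∀ r r' → 1 ≤ r' → CoprimeReduction r r'
coprimeReduction r r' 1≤r' = record
  { g = gcd r r' ; R = r / gcd r r' ; R' = r' / gcd r r'
  ; g-pos   = >-nonZero⁻¹ (gcd r r')
  ; r≡R*g   = sym (m/n*n≡m (gcd[m,n]∣m r r'))
  ; r'≡R'*g = sym (m/n*n≡m (gcd[m,n]∣n r r'))
  ; coprime = coprime-/gcd r r'
  }
  where
  instance
    g≢0 : NonZero (gcd r r')
    g≢0 = ℕ.≢-nonZero (gcd[m,n]≢0 r r' (inj₂ (ℕ.≢-nonZero⁻¹ r' {{>-nonZero 1≤r'}})))

cross-cancel : ∀ b s s' R R' g → 1 ≤ g →
  s * (R' * g) ^ b ≡ s' * (R * g) ^ b → s * R' ^ b ≡ s' * R ^ b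
cross-cancel b s s' R R' g 1≤g cross =
  ℕP.*-cancelʳ-≡ _ _ (g ^ b) {{ℕP.m^n≢0 g b {{>-nonZero 1≤g}}}}
    (trans (sym (pull s R')) (trans cross (pull s' R)))
  where
  pull : ∀ x X → x * (X * g) ^ b ≡ x * X ^ b * g ^ b
  pull x X = begin
    x * (X * g) ^ b      ≡⟨ cong (x *_) (^-distribʳ-* X g b) ⟩
    x * (X ^ b * g ^ b)  ≡⟨ ℕP.*-assoc x (X ^ b) (g ^ b) ⟨
    x * X ^ b * g ^ b    ∎
    where open ≡-Reasoning

coprime-cross⇒∣ : ∀ b s s' R R' → Coprime R R' →
  s * R' ^ b ≡ s' * R ^ b → R ^ b ∣ s
coprime-cross⇒∣ b s s' R R' R⊥R' cross = coprime-divisor (coprime-^ b R⊥R')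
  (subst (R ^ b ∣_) (trans (sym cross) (ℕP.*-comm s (R' ^ b))) (n∣m*n s'))

cross⇒primeWitness : ∀ b r s r' s' → 1 ≤ r' → r' < r →
  s * r' ^ b ≡ s' * r ^ b → Σ ℕ λ p → Prime p × p ∣ r × p ^ b ∣ s
cross⇒primeWitness b r s r' s' 1≤r' r'<r cross
  with coprimeReduction r r' 1≤r'
... | record { g = g ; R = R ; R' = R' ; g-pos = 1≤g
             ; r≡R*g = refl ; r'≡R'*g = refl ; coprime = R⊥R' }
  with primeDivisor R 1<R
  where
  1<R : 1 < R
  1<R = ℕP.≤-<-trans (factor-pos R' 1≤r' refl) (ℕP.*-cancelʳ-< g R' R r'<r)
... | p , p-prime , p∣R =
  p , p-prime , ∣-trans p∣R (divides g (ℕP.*-comm R g)) ,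
  ∣-trans (^-monoˡ-∣ b p∣R)
          (coprime-cross⇒∣ b s s' R R' R⊥R' (cross-cancel b s s' R R' g 1≤g cross))

ι≡mkℚ : ∀ m → ι m ≡ mkℚ (+ m) 0 (Coprime.sym (Coprime.1-coprimeTo m))
ι≡mkℚ m = ℚP.normalize-coprime (Coprime.sym (Coprime.1-coprimeTo m))

ι-* : ∀ a c → ι (a * c) ≡ ι a ℚ.* ι c
ι-* a c rewrite ι≡mkℚ a | ι≡mkℚ c = cong (ℚ._/ 1) (ℤP.pos-* a c)

ι-injective : ∀ {a c} → ι a ≡ ι c → a ≡ c
ι-injective {a} {c} eq =
  ℤP.+-injective (cong ℚ.↥_ (trans (sym (ι≡mkℚ a)) (trans eq (ι≡mkℚ c))))

ι-nonZero : ∀ m → 1 ≤ m → ℚ.NonZero (ι m)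
ι-nonZero m@(suc _) _ rewrite ι≡mkℚ m = _

*-cancelʳ-≡ : ∀ x y q .{{_ : ℚ.NonZero q}} → x ℚ.* q ≡ y ℚ.* q → x ≡ y
*-cancelʳ-≡ x y q eq = begin
  x                    ≡⟨ ℚP.*-identityʳ x ⟨
  x ℚ.* 1ℚ             ≡⟨ cong (x ℚ.*_) (ℚP.*-inverseʳ q) ⟨
  x ℚ.* (q ℚ.* 1/ q)   ≡⟨ ℚP.*-assoc x q (1/ q) ⟨
  x ℚ.* q ℚ.* 1/ q     ≡⟨ cong (ℚ._* 1/ q) eq ⟩
  y ℚ.* q ℚ.* 1/ q     ≡⟨ ℚP.*-assoc y q (1/ q) ⟩
  y ℚ.* (q ℚ.* 1/ q)   ≡⟨ cong (y ℚ.*_) (ℚP.*-inverseʳ q) ⟩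
  y ℚ.* 1ℚ             ≡⟨ ℚP.*-identityʳ y ⟩
  y                    ∎
  where open ≡-Reasoning

onGraph⇒cross : ∀ b n r s r' s' → OnGraph b n r s → OnGraph b n r' s' →
  s * r' ^ b ≡ s' * r ^ b
onGraph⇒cross b n r s r' s' on on' = ι-injective (begin
  ι (s * r' ^ b)                   ≡⟨ ι-* s (r' ^ b) ⟩
  ι s ℚ.* ι (r' ^ b)               ≡⟨ cong (ℚ._* ι (r' ^ b)) on ⟩
  n ℚ.* ι (r ^ b) ℚ.* ι (r' ^ b)   ≡⟨ ℚP.*-assoc n _ _ ⟩
  n ℚ.* (ι (r ^ b) ℚ.* ι (r' ^ b)) ≡⟨ cong (n ℚ.*_) (ℚP.*-comm (ι (r ^ b)) _) ⟩
  n ℚ.* (ι (r' ^ b) ℚ.* ι (r ^ b)) ≡⟨ ℚP.*-assoc n _ _ ⟨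
  n ℚ.* ι (r' ^ b) ℚ.* ι (r ^ b)   ≡⟨ cong (ℚ._* ι (r ^ b)) on' ⟨
  ι s' ℚ.* ι (r ^ b)               ≡⟨ ι-* s' (r ^ b) ⟨
  ι (s' * r ^ b)                   ∎)
  where open ≡-Reasoning

onGraph-unscale : ∀ b n R S k → 1 ≤ k →
  OnGraph b n (R * k) (S * k ^ b) → OnGraph b n R S
onGraph-unscale b n R S k 1≤k on =
  *-cancelʳ-≡ _ _ (ι (k ^ b)) {{ι-nonZero (k ^ b) (ℕP.m^n>0 k {{>-nonZero 1≤k}} b)}} (begin
    ι S ℚ.* ι (k ^ b)               ≡⟨ ι-* S (k ^ b) ⟨
    ι (S * k ^ b)                   ≡⟨ on ⟩
    n ℚ.* ι ((R * k) ^ b)           ≡⟨ cong (λ x → n ℚ.* ι x) (^-distribʳ-* R k b) ⟩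
    n ℚ.* ι (R ^ b * k ^ b)         ≡⟨ cong (n ℚ.*_) (ι-* (R ^ b) (k ^ b)) ⟩
    n ℚ.* (ι (R ^ b) ℚ.* ι (k ^ b)) ≡⟨ ℚP.*-assoc n _ _ ⟨
    n ℚ.* ι (R ^ b) ℚ.* ι (k ^ b)   ∎)
  where open ≡-Reasoning

primeWitness⇒nearerPoint : ∀ b n r s p → 1 ≤ r → 1 ≤ s → Prime p →
  p ∣ r → p ^ b ∣ s → OnGraph b n r s →
  Σ ℕ λ r' → Σ ℕ λ s' → 1 ≤ r' × 1 ≤ s' × r' < r × OnGraph b n r' s'
primeWitness⇒nearerPoint b n r s p 1≤r 1≤s p-prime
  (divides R r≡R*p) (divides S s≡S*pᵇ) on =
  R , S , factor-pos R 1≤r r≡R*p , factor-pos S 1≤s s≡S*pᵇ ,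
  quotient-< 1≤r (ℕ.nonTrivial⇒n>1 p {{prime⇒nonTrivial p-prime}}) r≡R*p ,
  onGraph-unscale b n R S p (>-nonZero⁻¹ p {{prime⇒nonZero p-prime}})
    (subst₂ (OnGraph b n) r≡R*p s≡S*pᵇ on)

proposition1 : (b r s : ℕ) → 1 ≤ b → 1 ≤ r → 1 ≤ s →
    Visible b r s ⇔
      ((Σ ℚ λ n → OnGraph b n r s) × ¬ (Σ ℕ λ p → Prime p × p ∣ r × (p ^ b) ∣ s))
proposition1 b r s _ 1≤r 1≤s = mk⇔ visible⇒noPrime noPrime⇒visible
  where
  visible⇒noPrime : Visible b r s →
    (Σ ℚ λ n → OnGraph b n r s) × ¬ (Σ ℕ λ p → Prime p × p ∣ r × (p ^ b) ∣ s)
  visible⇒noPrime (n , on , noNearer) = (n , on) , λ (p , p-prime , p∣r , pᵇ∣s) →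
    noNearer (primeWitness⇒nearerPoint b n r s p 1≤r 1≤s p-prime p∣r pᵇ∣s on)

  noPrime⇒visible :
    (Σ ℚ λ n → OnGraph b n r s) × ¬ (Σ ℕ λ p → Prime p × p ∣ r × (p ^ b) ∣ s) →
    Visible b r s
  noPrime⇒visible ((n , on) , noPrime) = n , on , λ (r' , s' , 1≤r' , _ , r'<r , on') →
    noPrime (cross⇒primeWitness b r s r' s' 1≤r' r'<r
              (onGraph⇒cross b n r s r' s' on on'))
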